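{- Let $n,k,s$ be positive integers with $1 \le s < k < n$. Then the overlap graph $P(k,n,s)$ is hamiltonian, i.e. it contains a directed cycle passing through every vertex exactly once.
   Context: A $k$-permutation of $[n]=\{1,\ldots,n\}$ is a string $a_1a_2\ldots a_k$ of $k$ pairwise distinct elements of $[n]$. The overlap graph $P(k,n,s)$ is the directed graph whose vertices are the $k$-permutations of $[n]$, with an arc from $a_1a_2\ldots a_k$ to $b_1b_2\ldots b_k$ if and only if $a_{k-s+1}a_{k-s+2}\ldots a_k = b_1b_2\ldots b_s$. -}

module Defs where

open import Data.Nat using (ℕ; suc; _+_; _∸_; _<_; NonZero)
open import Data.Nat.DivMod using (_%_; m%n<n)
open import Data.Fin using (Fin; toℕ; fromℕ<)
open import Data.Vec using (Vec; lookup)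
open import Data.Product using (Σ; Σ-syntax; ∃; _×_)
open import Relation.Binary.PropositionalEquality using (_≡_; _≢_)

-- A k-permutation of [n] = {1..n}: a length-k word over Fin n (standing for [n])
-- whose letters are pairwise distinct.
record KPerm (k n : ℕ) : Set where
  constructor kperm
  field
    word     : Vec (Fin n) k
    distinct : ∀ (i j : Fin k) → i ≢ j → lookup word i ≢ lookup word j
open KPerm public

-- Arc relation of the overlap graph P(k,n,s):
-- a_{k-s+1} ... a_k = b_1 ... b_s, i.e. (0-indexed) for every j < s,
-- letter (k-s)+j of a equals letter j of b.
Arc : (k n s : ℕ) → KPerm k n → KPerm k n → Set
Arc k n s a b = ∀ (i j : Fin k) → toℕ j < s → toℕ i ≡ (k ∸ s) + toℕ j →
                lookup (word a) i ≡ lookup (word b) j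

nextFin : (m : ℕ) → .{{_ : NonZero m}} → Fin m → Fin m
nextFin m i = fromℕ< (m%n<n (suc (toℕ i)) m)

-- Vertices are compared by an equality _≈_ (for k-permutations: equality of the words,
-- so that the propositional distinctness proofs play no role).
HamiltonianCycle : (V : Set) → (_≈_ : V → V → Set) → (V → V → Set) → Set
HamiltonianCycle V _≈_ E =
  Σ[ m ∈ ℕ ] Σ[ c ∈ (Fin (suc m) → V) ]
    ((∀ i j → c i ≈ c j → i ≡ j) ×
     (∀ v → ∃ λ i → c i ≈ v) ×
     (∀ i → E (c i) (c (nextFin (suc m) i))))

IsHamiltonianP : (k n s : ℕ) → Set
IsHamiltonianP k n s = HamiltonianCycle (KPerm k n) (λ a b → word a ≡ word b) (Arc k n s)

module Submission where

-- Write k = d + s with d ≥ 1 and view vertices as repetition-free words of length k.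
-- Rotating a word by d letters, ρ w = drop d w ++ take d w, is a permutation of the
-- vertices with w ⟶ ρ w, so the ρ-orbits partition P(k,n,s) into disjoint cycles.  Two
-- words are twins when they agree after position d; twins have the same out-neighbours,
-- so the orbit of a twin y of a vertex x can be spliced into a cycle right after x.
--
-- Module Overlap instantiates it: connectivity holds because twins
-- may change the first d letters, rotations bring any block of positions to the front,
-- and a spare letter (k < n) lets one change a word into any other letter by letter.

open import Defs
open import Data.Nat using (ℕ; zero; suc; _+_; _*_; _∸_; _≤_; _<_; z≤n; s≤s)
import Data.Nat as ℕ
open import Data.Nat.Properties
open import Data.Nat.DivMod using (_/_; _%_; m%n<n; m≡m%n+[m/n]*n; m/n*n≤m; m<n⇒m%n≡m; n%n≡0)
open import Data.Nat.GeneralisedArithmetic using (iterate)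
open import Data.Fin using (Fin; toℕ)
import Data.Fin as Fin
open import Data.Fin.Properties using (toℕ<n; toℕ-fromℕ<; toℕ-injective)
  renaming (suc-injective to Fin-suc-injective)
open import Data.Maybe using (Maybe; just; nothing)
open import Data.Maybe.Properties using (just-injective)
open import Data.Product using (Σ; ∃; _×_; _,_; proj₁; proj₂)
open import Data.Sum using (_⊎_; inj₁; inj₂; [_,_]′)
open import Data.Empty using (⊥; ⊥-elim)
open import Data.List using (List; []; _∷_; _++_; [_]; length; take; drop; applyUpTo; allFin; cartesianProductWith)
open import Data.List.Properties
  using (applyUpTo-∷ʳ; ++-assoc; ++-identityʳ; take++drop≡id; length-take; length-drop; drop-drop; length-++;
         length-tabulate; ≡-dec)
import Data.List.Relation.Unary.All as All
open import Data.List.Relation.Unary.AllPairs using ([]; _∷_)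
open import Data.List.Relation.Unary.Any using (here; there; any?)
open import Data.List.Relation.Unary.Linked using (Linked; []; [-]; _∷_)
import Data.List.Relation.Unary.Linked.Properties as Linked
open import Data.List.Relation.Unary.Unique.Propositional using (Unique)
import Data.List.Relation.Unary.Unique.Propositional.Properties as Unique
open import Data.List.Relation.Binary.Permutation.Propositional using (_↭_; ↭-prep; ↭-sym; ↭-trans; ↭-reflexive; ↭⇒↭ₛ)
open import Data.List.Relation.Binary.Permutation.Propositional.Properties using (↭-length; ++-comm; shift; ∈-resp-↭; ++⁺ˡ)
open import Data.List.Relation.Binary.Permutation.Setoid.Properties using (Unique-resp-↭)
open import Data.List.Membership.Propositional using (_∈_; _∉_; find; lose)
open import Data.List.Membership.Propositional.Properties
  using (∈-allFin; ∈-cartesianProductWith⁺; ∈-length; ∈-applyUpTo⁺; ∈-applyUpTo⁻; ∈-∃++; ∈-++⁺ˡ; ∈-++⁺ʳ; ∈-++⁻)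
open import Data.Vec using (Vec; []; _∷_)
import Data.Vec as Vec
open import Data.Vec.Properties using (toList-cast; toList∘fromList; fromList∘toList; length-toList)
open import Data.Vec.Membership.Propositional using () renaming (_∈_ to _∈ᵥ_)
open import Data.Vec.Membership.Propositional.Properties using (∈-lookup; ∈-toList⁺; ∈-toList⁻)
import Data.Vec.Relation.Unary.Any as VAny
import Data.Vec.Relation.Unary.Any.Properties as VAny
open import Relation.Nullary using (¬_; ¬?; Dec; yes; no)
open import Relation.Nullary.Decidable using (_×-dec_; decidable-stable)
open import Relation.Binary.Definitions using (DecidableEquality)
open import Relation.Binary.PropositionalEquality
  using (_≡_; _≢_; refl; sym; trans; cong; cong₂; subst; setoid; module ≡-Reasoning)

iterate-suc : ∀ {A : Set} (f : A → A) x m → iterate f x (suc m) ≡ f (iterate f x m)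
iterate-suc f x zero    = refl
iterate-suc f x (suc m) = iterate-suc f (f x) m

iterate-+ : ∀ {A : Set} (f : A → A) x a b → iterate f x (a + b) ≡ iterate f (iterate f x a) b
iterate-+ f x zero    b = refl
iterate-+ f x (suc a) b = iterate-+ f (f x) a b

iterate-preserves : ∀ {A : Set} (P : A → Set) (f : A → A) → (∀ {x} → P x → P (f x)) →
                    ∀ {x} m → P x → P (iterate f x m)
iterate-preserves P f pres zero    px = px
iterate-preserves P f pres (suc m) px = iterate-preserves P f pres m (pres px)

-- Every satisfiable decidable predicate on ℕ has a least witness
-- (used to find the exact period of a vertex under the rotation).

least-witness : (P : ℕ → Set) → (∀ i → Dec (P i)) → ∀ {m} → P m →
                ∃ λ j → P j × (∀ i → i < j → ¬ P i)
least-witness P P? {m} pm = search 0 m (λ _ ()) pm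
  where
  extend : ∀ {i} → (∀ j → j < i → ¬ P j) → ¬ P i → ∀ j → j < suc i → ¬ P j
  extend below ¬pi j j<1+i with m≤n⇒m<n∨m≡n (≤-pred j<1+i)
  ... | inj₁ j<i   = below j j<i
  ... | inj₂ refl = ¬pi

  search : ∀ i f → (∀ j → j < i → ¬ P j) → P (i + f) → ∃ λ j → P j × (∀ i → i < j → ¬ P i)
  search i f below p with P? i
  search i f       below p | yes pi  = i , pi , below
  search i zero    below p | no  ¬pi = ⊥-elim (¬pi (subst P (+-identityʳ i) p))
  search i (suc f) below p | no  ¬pi = search (suc i) f (extend below ¬pi) (subst P (+-suc i f) p)

module _ {A : Set} where

  rotate : ℕ → List A → List A
  rotate j l = drop j l ++ take j l

  rotate-↭ : ∀ j l → rotate j l ↭ l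
  rotate-↭ j l = ↭-trans (++-comm (drop j l) (take j l)) (↭-reflexive (take++drop≡id j l))

  length-rotate : ∀ j l → length (rotate j l) ≡ length l
  length-rotate j l = ↭-length (rotate-↭ j l)

  rotate-one-++ : ∀ (p q : List A) → iterate (rotate 1) (p ++ q) (length p) ≡ q ++ p
  rotate-one-++ []      q = sym (++-identityʳ q)
  rotate-one-++ (x ∷ p) q = begin
    iterate (rotate 1) ((p ++ q) ++ [ x ]) (length p) ≡⟨ cong (λ l → iterate (rotate 1) l (length p)) (++-assoc p q [ x ]) ⟩
    iterate (rotate 1) (p ++ q ++ [ x ]) (length p)   ≡⟨ rotate-one-++ p (q ++ [ x ]) ⟩
    (q ++ [ x ]) ++ p                                 ≡⟨ ++-assoc q [ x ] p ⟩
    q ++ x ∷ p                                        ∎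
    where open ≡-Reasoning

  rotate-one-iterate : ∀ j l → j ≤ length l → iterate (rotate 1) l j ≡ rotate j l
  rotate-one-iterate j l j≤ = begin
    iterate (rotate 1) l j                         ≡⟨ cong (λ l′ → iterate (rotate 1) l′ j) (sym (take++drop≡id j l)) ⟩
    iterate (rotate 1) (take j l ++ drop j l) j    ≡⟨ cong (iterate (rotate 1) (take j l ++ drop j l)) (sym |take|) ⟩
    iterate (rotate 1) (take j l ++ drop j l) (length (take j l)) ≡⟨ rotate-one-++ (take j l) (drop j l) ⟩
    rotate j l                                     ∎
    where
    open ≡-Reasoning
    |take| : length (take j l) ≡ j
    |take| = trans (length-take j l) (m≤n⇒m⊓n≡m j≤)

  rotate-one-turns : ∀ a l → iterate (rotate 1) l (a * length l) ≡ l
  rotate-one-turns zero    l = refl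
  rotate-one-turns (suc a) l = begin
    iterate (rotate 1) l (length l + a * length l)           ≡⟨ iterate-+ (rotate 1) l (length l) (a * length l) ⟩
    iterate (rotate 1) (iterate (rotate 1) l (length l)) (a * length l)
      ≡⟨ cong (λ l′ → iterate (rotate 1) l′ (a * length l)) full ⟩
    iterate (rotate 1) l (a * length l)                      ≡⟨ rotate-one-turns a l ⟩
    l                                                        ∎
    where
    open ≡-Reasoning
    full : iterate (rotate 1) l (length l) ≡ l
    full = trans (cong (λ l′ → iterate (rotate 1) l′ (length l)) (sym (++-identityʳ l))) (rotate-one-++ l [])

  iterate-rotate : ∀ j l → j ≤ length l → ∀ m → iterate (rotate j) l m ≡ iterate (rotate 1) l (m * j)
  iterate-rotate j l j≤ zero    = refl
  iterate-rotate j l j≤ (suc m) = begin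
    iterate (rotate j) (rotate j l) m
      ≡⟨ iterate-rotate j (rotate j l) (subst (j ≤_) (sym (length-rotate j l)) j≤) m ⟩
    iterate (rotate 1) (rotate j l) (m * j)
      ≡⟨ cong (λ l′ → iterate (rotate 1) l′ (m * j)) (sym (rotate-one-iterate j l j≤)) ⟩
    iterate (rotate 1) (iterate (rotate 1) l j) (m * j) ≡⟨ sym (iterate-+ (rotate 1) l j (m * j)) ⟩
    iterate (rotate 1) l (j + m * j)                    ∎
    where open ≡-Reasoning

  rotate-period : ∀ j l → j ≤ length l → iterate (rotate j) l (length l) ≡ l
  rotate-period j l j≤ = begin
    iterate (rotate j) l (length l)          ≡⟨ iterate-rotate j l j≤ (length l) ⟩
    iterate (rotate 1) l (length l * j)      ≡⟨ cong (iterate (rotate 1) l) (*-comm (length l) j) ⟩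
    iterate (rotate 1) l (j * length l)      ≡⟨ rotate-one-turns j l ⟩
    l                                        ∎
    where open ≡-Reasoning

  iterate-rotate-within : ∀ j l → j ≤ length l → ∀ m → m * j ≤ length l →
                          iterate (rotate j) l m ≡ rotate (m * j) l
  iterate-rotate-within j l j≤ m le =
    trans (iterate-rotate j l j≤ m) (rotate-one-iterate (m * j) l le)

  length-replace : ∀ (u v : List A) a b → length (u ++ a ∷ v) ≡ length (u ++ b ∷ v)
  length-replace u v a b = trans (↭-length (shift a u v)) (sym (↭-length (shift b u v)))

  ∈-mid : ∀ (u v : List A) a {x} → x ∈ u ++ a ∷ v → x ≡ a ⊎ x ∈ u ++ v
  ∈-mid u v a x∈ with ∈-resp-↭ (shift a u v) x∈
  ... | here x≡a  = inj₁ x≡a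
  ... | there x∈′ = inj₂ x∈′

  ∈-mid⁺ : ∀ (u v : List A) a {x} → x ∈ u ++ v → x ∈ u ++ a ∷ v
  ∈-mid⁺ u v a x∈ = ∈-resp-↭ (↭-sym (shift a u v)) (there x∈)

  unique-mid⁻ : ∀ (u v : List A) a → Unique (u ++ a ∷ v) → Unique (a ∷ u ++ v)
  unique-mid⁻ u v a un = Unique-resp-↭ (setoid A) (↭⇒↭ₛ (shift a u v)) un

  ∉-mid : ∀ (u v : List A) a → Unique (u ++ a ∷ v) → a ∉ u ++ v
  ∉-mid u v a un = Unique.Unique[x∷xs]⇒x∉xs (unique-mid⁻ u v a un)

  unique-replace : ∀ (u v : List A) a b → Unique (u ++ a ∷ v) → b ∉ u ++ a ∷ v → Unique (u ++ b ∷ v)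
  unique-replace u v a b un b∉ with unique-mid⁻ u v a un
  ... | _ ∷ un′ = Unique-resp-↭ (setoid A) (↭⇒↭ₛ (↭-sym (shift b u v)))
                    (All.tabulate (λ y∈ b≡y → b∉ (∈-mid⁺ u v a (subst (_∈ u ++ v) (sym b≡y) y∈))) ∷ un′)

  unique-⊆-length : ∀ (xs ys : List A) → Unique xs → (∀ {x} → x ∈ xs → x ∈ ys) → length xs ≤ length ys
  unique-⊆-length []       ys un       ⊆ys = z≤n
  unique-⊆-length (x ∷ xs) ys (x∉ ∷ un) ⊆ys with ∈-∃++ (⊆ys (here refl))
  ... | p , q , refl = subst (suc (length xs) ≤_) (sym (↭-length (shift x p q)))
                         (s≤s (unique-⊆-length xs (p ++ q) un ⊆p++q))
    where
    ⊆p++q : ∀ {y} → y ∈ xs → y ∈ p ++ q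
    ⊆p++q {y} y∈ with ∈-mid p q x (⊆ys (there y∈))
    ... | inj₁ y≡x  = ⊥-elim (All.lookup x∉ y∈ (sym y≡x))
    ... | inj₂ y∈′ = y∈′

  take-++-exact : ∀ (xs ys : List A) {m} → length xs ≡ m → take m (xs ++ ys) ≡ xs
  take-++-exact []       ys refl = refl
  take-++-exact (x ∷ xs) ys refl = cong (x ∷_) (take-++-exact xs ys refl)

  drop-++-exact : ∀ (xs ys : List A) {m} → length xs ≡ m → drop m (xs ++ ys) ≡ ys
  drop-++-exact []       ys refl = refl
  drop-++-exact (x ∷ xs) ys refl = drop-++-exact xs ys refl

  take-++ˡ : ∀ j (xs ys : List A) → j ≤ length xs → take j (xs ++ ys) ≡ take j xs
  take-++ˡ zero    xs       ys _       = refl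
  take-++ˡ (suc j) (x ∷ xs) ys (s≤s j≤) = cong (x ∷_) (take-++ˡ j xs ys j≤)

  drop-++ˡ : ∀ j (xs ys : List A) → j ≤ length xs → drop j (xs ++ ys) ≡ drop j xs ++ ys
  drop-++ˡ zero    xs       ys _       = refl
  drop-++ˡ (suc j) (x ∷ xs) ys (s≤s j≤) = drop-++ˡ j xs ys j≤

  take-replace : ∀ (u v : List A) a b j → j ≤ length u → take j (u ++ a ∷ v) ≡ take j (u ++ b ∷ v)
  take-replace u v a b j j≤ = trans (take-++ˡ j u (a ∷ v) j≤) (sym (take-++ˡ j u (b ∷ v) j≤))

  drop-replace : ∀ (u v : List A) a b j → length u < j → drop j (u ++ a ∷ v) ≡ drop j (u ++ b ∷ v)
  drop-replace []      v a b (suc j) _        = refl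
  drop-replace (x ∷ u) v a b (suc j) (s≤s u<j) = drop-replace u v a b j u<j

module _ {A : Set} {R : A → A → Set} where

  linked-join : ∀ {x} O {y} r → Linked R (x ∷ O ++ [ y ]) → Linked R (y ∷ r) → Linked R (x ∷ O ++ y ∷ r)
  linked-join []      r (x⟶y ∷ [-]) wy = x⟶y ∷ wy
  linked-join (o ∷ O) r (x⟶o ∷ wo)  wy = x⟶o ∷ linked-join O r wo wy

  linked-retarget : ∀ {x y} r → (∀ {z} → R x z → R y z) → Linked R (x ∷ r) → Linked R (y ∷ r)
  linked-retarget []      out [-]         = [-]
  linked-retarget (z ∷ r) out (x⟶z ∷ wz) = out x⟶z ∷ wz

  linked-splice : ∀ p {x} r O {y} → (∀ {z} → R x z → R y z) →
                  Linked R (p ++ x ∷ r) → Linked R (x ∷ O ++ [ y ]) → Linked R (p ++ x ∷ O ++ y ∷ r)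
  linked-splice []           r O out w wO = linked-join O r wO (linked-retarget r out w)
  linked-splice (q ∷ [])     r O out (q⟶x ∷ w) wO = q⟶x ∷ linked-splice [] r O out w wO
  linked-splice (q ∷ q′ ∷ p) r O out (q⟶q′ ∷ w) wO = q⟶q′ ∷ linked-splice (q′ ∷ p) r O out w wO

-- If the valid vertices are connected under ρ and ∼, the digraph has a
-- Hamiltonian cycle: start from one ρ-orbit (itself a cycle) and, as long as some vertex
-- x of the current cycle has a twin y outside it, splice the whole ρ-orbit of y,
-- which runs from ρ y to y, in right after x.
module CycleJoining
  {V : Set} (_≟_ : DecidableEquality V)
  (Valid : V → Set) (valid? : ∀ v → Dec (Valid v))
  (univ : List V) (univ-complete : ∀ {v} → Valid v → v ∈ univ)
  (_⟶_ : V → V → Set)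
  (ρ : V → V) (ρ-valid : ∀ {v} → Valid v → Valid (ρ v))
  (period : ℕ) (ρ-period : ∀ {v} → Valid v → iterate ρ v (suc period) ≡ v)
  (ρ-arc : ∀ {v} → Valid v → v ⟶ ρ v)
  (_∼_ : V → V → Set) (_∼?_ : ∀ x y → Dec (x ∼ y))
  (∼-out : ∀ {x y z} → x ∼ y → x ⟶ z → y ⟶ z)
  (∼-out⁻ : ∀ {x y z} → x ∼ y → y ⟶ z → x ⟶ z)
  (connected : ∀ (P : V → Set) → (∀ {v} → Valid v → P v → P (ρ v)) →
               (∀ {w w′} → Valid w → Valid w′ → w ∼ w′ → P w → P w′) →
               ∀ {a} → Valid a → P a → ∀ {t} → Valid t → P t)
  {a₀ : V} (a₀-valid : Valid a₀)
  where

  open import Data.List.Membership.DecPropositional _≟_ using (_∈?_)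

  -- ρ, having finite order, is injective on vertices
  ρ-injective : ∀ {u w} → Valid u → Valid w → ρ u ≡ ρ w → u ≡ w
  ρ-injective {u} {w} vu vw e = begin
    u                         ≡⟨ sym (ρ-period vu) ⟩
    iterate ρ (ρ u) period    ≡⟨ cong (λ x → iterate ρ x period) e ⟩
    iterate ρ (ρ w) period    ≡⟨ ρ-period vw ⟩
    w                         ∎
    where open ≡-Reasoning

  iterate-injective : ∀ m {u w} → Valid u → Valid w → iterate ρ u m ≡ iterate ρ w m → u ≡ w
  iterate-injective zero    vu vw e = e
  iterate-injective (suc m) vu vw e = ρ-injective vu vw (iterate-injective m (ρ-valid vu) (ρ-valid vw) e)

  -- The ρ-orbit of y, listed as ρ y, ρ² y, …, y.
  record Orbit (y : V) : Set where
    field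
      inner    : List V
      unique   : Unique (inner ++ [ y ])
      linked   : ∀ {x} → x ⟶ ρ y → Linked _⟶_ (x ∷ inner ++ [ y ])
      ρ-closed : ∀ {v} → v ∈ inner ++ [ y ] → ρ v ∈ inner ++ [ y ]
      valid    : ∀ {v} → v ∈ inner ++ [ y ] → Valid v
      returns  : ∀ {v} → v ∈ inner ++ [ y ] → ∃ λ c → iterate ρ v c ≡ y

  -- With f i = ρ^(i+1) y and p + 1 the least period of y, the orbit is f 0, …, f p.
  orbit : ∀ {y} → Valid y → Orbit y
  orbit {y} vy = record
    { inner    = applyUpTo f p
    ; unique   = subst Unique orbit≡ (Unique.applyUpTo⁺₁ f (suc p) entries-distinct)
    ; linked   = λ x⟶ρy → subst (λ l → Linked _⟶_ (_ ∷ l)) orbit≡ (x⟶ρy ∷ Linked.applyUpTo⁺₂ f (suc p) step)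
    ; ρ-closed = λ v∈ → subst (_ ∈_) orbit≡ (closed (subst (_ ∈_) (sym orbit≡) v∈))
    ; valid    = λ v∈ → member-valid (subst (_ ∈_) (sym orbit≡) v∈)
    ; returns  = λ v∈ → member-returns (subst (_ ∈_) (sym orbit≡) v∈)
    }
    where
    open ≡-Reasoning
    f : ℕ → V
    f = iterate ρ (ρ y)

    least : ∃ λ p → f p ≡ y × (∀ c → c < p → f c ≢ y)
    least = least-witness (λ i → f i ≡ y) (λ i → f i ≟ y) {period} (ρ-period vy)
    p : ℕ
    p = proj₁ least
    f-p : f p ≡ y
    f-p = proj₁ (proj₂ least)
    before-p : ∀ c → c < p → f c ≢ y
    before-p = proj₂ (proj₂ least)

    orbit≡ : applyUpTo f (suc p) ≡ applyUpTo f p ++ [ y ]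
    orbit≡ = trans (sym (applyUpTo-∷ʳ f p)) (cong (λ z → applyUpTo f p ++ [ z ]) f-p)

    f-valid : ∀ i → Valid (f i)
    f-valid i = iterate-preserves Valid ρ ρ-valid i (ρ-valid vy)

    step : ∀ i → f i ⟶ f (suc i)
    step i = subst (f i ⟶_) (sym (iterate-suc ρ (ρ y) i)) (ρ-arc (f-valid i))

    -- f (c + 1 + i) = f i forces f c = y, so entries within one period differ
    entries-distinct : ∀ {i j} → i < j → j < suc p → f i ≢ f j
    entries-distinct {i} {j} i<j j≤p fi≡fj = before-p c c<p (sym (ρ-injective vy (f-valid c) ρy≡))
      where
      c = proj₁ (m≤n⇒∃[o]m+o≡n i<j)
      j≡ : suc c + i ≡ j
      j≡ = trans (cong suc (+-comm c i)) (proj₂ (m≤n⇒∃[o]m+o≡n i<j))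
      c<p : c < p
      c<p = ≤-trans (s≤s (m≤m+n c i)) (≤-pred (subst (_< suc p) (sym j≡) j≤p))
      ρy≡ : ρ y ≡ ρ (f c)
      ρy≡ = trans (iterate-injective i (ρ-valid vy) (f-valid (suc c)) (begin
        iterate ρ (ρ y) i              ≡⟨ fi≡fj ⟩
        f j                            ≡⟨ cong f (sym j≡) ⟩
        f (suc c + i)                  ≡⟨ iterate-+ ρ (ρ y) (suc c) i ⟩
        iterate ρ (f (suc c)) i        ∎))
        (iterate-suc ρ (ρ y) c)

    member-valid : ∀ {v} → v ∈ applyUpTo f (suc p) → Valid v
    member-valid v∈ with ∈-applyUpTo⁻ f v∈
    ... | i , _ , refl = f-valid i

    closed : ∀ {v} → v ∈ applyUpTo f (suc p) → ρ v ∈ applyUpTo f (suc p)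
    closed v∈ with ∈-applyUpTo⁻ f v∈
    ... | i , i≤p , refl with m≤n⇒m<n∨m≡n (≤-pred i≤p)
    ...   | inj₁ i<p = subst (_∈ applyUpTo f (suc p)) (iterate-suc ρ (ρ y) i) (∈-applyUpTo⁺ f (s≤s i<p))
    ...   | inj₂ i≡p = subst (_∈ applyUpTo f (suc p)) (cong ρ (sym (trans (cong f i≡p) f-p)))
                         (∈-applyUpTo⁺ f (s≤s z≤n))

    member-returns : ∀ {v} → v ∈ applyUpTo f (suc p) → ∃ λ c → iterate ρ v c ≡ y
    member-returns v∈ with ∈-applyUpTo⁻ f v∈
    ... | i , i≤p , refl = p ∸ i , (begin
      iterate ρ (f i) (p ∸ i)   ≡⟨ sym (iterate-+ ρ (ρ y) i (p ∸ i)) ⟩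
      f (i + (p ∸ i))           ≡⟨ cong f (m+[n∸m]≡n (≤-pred i≤p)) ⟩
      f p                       ≡⟨ f-p ⟩
      y                         ∎)

  Cyclic : List V → Set
  Cyclic []      = ⊥
  Cyclic (h ∷ t) = Linked _⟶_ (h ∷ t ++ [ h ])

  cyclic-splice : ∀ p {x} r O {y} → (∀ {z} → x ⟶ z → y ⟶ z) →
                  Cyclic (p ++ x ∷ r) → Linked _⟶_ (x ∷ O ++ [ y ]) → Cyclic (p ++ x ∷ O ++ y ∷ r)
  cyclic-splice [] {x} r O {y} out c wO =
    subst (λ l → Linked _⟶_ (x ∷ l)) (sym (++-assoc O (y ∷ r) [ x ]))
      (linked-splice [] (r ++ [ x ]) O out c wO)
  cyclic-splice (h ∷ p) {x} r O {y} out c wO =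
    subst (λ l → Linked _⟶_ (h ∷ l)) (sym reassoc)
      (linked-splice (h ∷ p) (r ++ [ h ]) O out
        (subst (λ l → Linked _⟶_ (h ∷ l)) (++-assoc p (x ∷ r) [ h ]) c) wO)
    where
    reassoc : (p ++ x ∷ O ++ y ∷ r) ++ [ h ] ≡ p ++ x ∷ O ++ y ∷ r ++ [ h ]
    reassoc = trans (++-assoc p (x ∷ O ++ y ∷ r) [ h ]) (cong (λ l → p ++ x ∷ l) (++-assoc O (y ∷ r) [ h ]))

  cyclic-nonempty : ∀ C → Cyclic C → ∃ λ a → a ∈ C
  cyclic-nonempty (h ∷ t) _ = h , here refl

  record PartialCycle : Set where
    field
      C        : List V
      cyclic   : Cyclic C
      unique   : Unique C
      valid    : ∀ {v} → v ∈ C → Valid v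
      ρ-closed : ∀ {v} → v ∈ C → ρ v ∈ C

  start : PartialCycle
  start = record
    { C        = a₀ ∷ inner
    ; cyclic   = linked (ρ-arc a₀-valid)
    ; unique   = Unique-resp-↭ (setoid V) (↭⇒↭ₛ rotated) unique
    ; valid    = λ v∈ → valid (∈-resp-↭ (↭-sym rotated) v∈)
    ; ρ-closed = λ v∈ → ∈-resp-↭ rotated (ρ-closed (∈-resp-↭ (↭-sym rotated) v∈))
    }
    where
    open Orbit (orbit a₀-valid)
    rotated : inner ++ [ a₀ ] ↭ a₀ ∷ inner
    rotated = ++-comm inner [ a₀ ]

  -- Splice the orbit of a twin y ∉ C of x ∈ C into C right after x.
  -- The orbit of y is disjoint from C, since C is ρ-closed and the orbit returns to y.
  merge : (st : PartialCycle) → ∀ {x y} → x ∈ PartialCycle.C st → Valid y → y ∉ PartialCycle.C st →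
          x ∼ y → Σ PartialCycle λ st′ → length (PartialCycle.C st) < length (PartialCycle.C st′)
  merge st {x} {y} x∈ vy y∉ x∼y with ∈-∃++ x∈
  ... | p , r , C≡ = record
    { C        = C′
    ; cyclic   = cyclic-splice p r inner (∼-out x∼y) (subst Cyclic C≡ cyclic)
                   (O.linked (∼-out⁻ x∼y (ρ-arc vy)))
    ; unique   = Unique-resp-↭ (setoid V) (↭⇒↭ₛ (↭-sym σ)) (Unique.++⁺ unique O.unique disjoint)
    ; valid    = λ v∈ → [ valid , O.valid ]′ (split v∈)
    ; ρ-closed = λ v∈ → [ (λ v∈C → inC (ρ-closed v∈C)) , (λ v∈O → inO (O.ρ-closed v∈O)) ]′ (split v∈)
    } , longer
    where
    open PartialCycle st
    module O = Orbit (orbit vy)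
    open O using (inner)
    Q : List V
    Q = inner ++ [ y ]
    C′ : List V
    C′ = p ++ x ∷ inner ++ y ∷ r

    σ : C′ ↭ C ++ Q
    σ = subst (C′ ↭_) (sym (trans (cong (_++ Q) C≡) (++-assoc p (x ∷ r) Q)))
          (subst (λ l → p ++ x ∷ l ↭ p ++ x ∷ r ++ Q) (++-assoc inner [ y ] r)
            (++⁺ˡ p (↭-prep x (++-comm Q r))))

    disjoint : ∀ {v} → ¬ (v ∈ C × v ∈ Q)
    disjoint (v∈C , v∈Q) with O.returns v∈Q
    ... | c , ρᶜv≡y = y∉ (subst (_∈ C) ρᶜv≡y (iterate-preserves (_∈ C) ρ ρ-closed c v∈C))

    split : ∀ {v} → v ∈ C′ → v ∈ C ⊎ v ∈ Q
    split v∈ = ∈-++⁻ C (∈-resp-↭ σ v∈)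
    inC : ∀ {v} → v ∈ C → v ∈ C′
    inC v∈ = ∈-resp-↭ (↭-sym σ) (∈-++⁺ˡ v∈)
    inO : ∀ {v} → v ∈ Q → v ∈ C′
    inO v∈ = ∈-resp-↭ (↭-sym σ) (∈-++⁺ʳ C v∈)

    longer : length C < length C′
    longer = begin-strict
      length C                    <⟨ m<m+n (length C) (∈-length (∈-++⁺ʳ inner (here refl))) ⟩
      length C + length Q         ≡⟨ sym (length-++ C) ⟩
      length (C ++ Q)             ≡⟨ sym (↭-length σ) ⟩
      length C′                   ∎
      where open ≤-Reasoning

  twin-exit? : (C : List V) →
    (∃ λ x → ∃ λ y → x ∈ C × Valid y × y ∉ C × x ∼ y) ⊎ (∀ {x y} → x ∈ C → Valid y → x ∼ y → y ∈ C)
  twin-exit? C with any? (λ x → any? (λ y → valid? y ×-dec (¬? (y ∈? C) ×-dec x ∼? y)) univ) C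
  ... | no none = inj₂ λ x∈ vy x∼y →
          decidable-stable (_ ∈? C) (λ y∉ → none (lose x∈ (lose (univ-complete vy) (vy , y∉ , x∼y))))
  ... | yes exit with find exit
  ...   | x , x∈ , exitˣ with find exitˣ
  ...     | y , _ , vy , y∉ , x∼y = inj₁ (x , y , x∈ , vy , y∉ , x∼y)

  size-bound : (st : PartialCycle) → length (PartialCycle.C st) ≤ length univ
  size-bound st = unique-⊆-length C univ unique (λ v∈ → univ-complete (valid v∈))
    where open PartialCycle st

  covers : (st : PartialCycle) → (∀ {x y} → x ∈ PartialCycle.C st → Valid y → x ∼ y → y ∈ PartialCycle.C st) →
           ∀ {v} → Valid v → v ∈ PartialCycle.C st
  covers st twin-closed = connected (_∈ C) (λ _ → ρ-closed) (λ _ vw′ w∼w′ w∈ → twin-closed w∈ vw′ w∼w′)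
                            (valid (proj₂ first)) (proj₂ first)
    where
    open PartialCycle st
    first : ∃ λ a → a ∈ C
    first = cyclic-nonempty C cyclic

  HamiltonianList : Set
  HamiltonianList = Σ PartialCycle λ st → ∀ {v} → Valid v → v ∈ PartialCycle.C st

  -- Grow the partial cycle until it is closed under twins; fuel bounds the missing vertices.
  grow : ∀ fuel (st : PartialCycle) → length univ ≤ fuel + length (PartialCycle.C st) → HamiltonianList
  grow fuel st bound with twin-exit? (PartialCycle.C st)
  ... | inj₂ twin-closed = st , covers st twin-closed
  ... | inj₁ (_ , _ , x∈ , vy , y∉ , x∼y) with merge st x∈ vy y∉ x∼y
  grow zero st bound | inj₁ _ | st′ , longer =
    ⊥-elim (<⇒≱ (<-≤-trans longer (size-bound st′)) bound)
  grow (suc fuel) st bound | inj₁ _ | st′ , longer =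
    grow fuel st′ (≤-trans bound (≤-trans (≤-reflexive (sym (+-suc fuel _))) (+-monoʳ-≤ fuel longer)))

  hamiltonian : HamiltonianList
  hamiltonian = grow (length univ) start (m≤m+n (length univ) _)

module _ {A : Set} where

  vecOf : ∀ {m} (l : List A) → length l ≡ m → Vec A m
  vecOf l e = Vec.cast e (Vec.fromList l)

  toList-vecOf : ∀ {m} (l : List A) (e : length l ≡ m) → Vec.toList (vecOf l e) ≡ l
  toList-vecOf l e = trans (toList-cast e (Vec.fromList l)) (toList∘fromList l)

  vecOf-toList : ∀ {m} (l : List A) (e : length l ≡ m) (w : Vec A m) → l ≡ Vec.toList w → vecOf l e ≡ w
  vecOf-toList _ e w refl = fromList∘toList w

  unique-toList : ∀ {m} (w : Vec A m) → (∀ i j → i ≢ j → Vec.lookup w i ≢ Vec.lookup w j) → Unique (Vec.toList w)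
  unique-toList []      _        = []
  unique-toList (x ∷ w) distinct′ =
    All.tabulate (λ y∈ x≡y → first≢ (∈-toList⁻ y∈) x≡y)
    ∷ unique-toList w (λ i j i≢j → distinct′ (Fin.suc i) (Fin.suc j) (λ e → i≢j (Fin-suc-injective e)))
    where
    first≢ : ∀ {y} → y ∈ᵥ w → x ≢ y
    first≢ y∈ x≡y = distinct′ Fin.zero (Fin.suc (VAny.index y∈)) (λ ()) (trans x≡y (VAny.lookup-index y∈))

  lookup-injective : ∀ {m} (w : Vec A m) → Unique (Vec.toList w) →
                     ∀ i j → Vec.lookup w i ≡ Vec.lookup w j → i ≡ j
  lookup-injective (x ∷ w) _        Fin.zero    Fin.zero    _ = refl
  lookup-injective (x ∷ w) (x∉ ∷ _) Fin.zero    (Fin.suc j) e = ⊥-elim (All.lookup x∉ (∈-toList⁺ (∈-lookup j w)) e)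
  lookup-injective (x ∷ w) (x∉ ∷ _) (Fin.suc i) Fin.zero    e = ⊥-elim (All.lookup x∉ (∈-toList⁺ (∈-lookup i w)) (sym e))
  lookup-injective (x ∷ w) (_ ∷ un) (Fin.suc i) (Fin.suc j) e = cong Fin.suc (lookup-injective w un i j e)

  at : List A → ℕ → Maybe A
  at []      _       = nothing
  at (x ∷ l) zero    = just x
  at (x ∷ l) (suc i) = at l i

  at-toList : ∀ {m} (w : Vec A m) i → at (Vec.toList w) (toℕ i) ≡ just (Vec.lookup w i)
  at-toList (x ∷ w) Fin.zero    = refl
  at-toList (x ∷ w) (Fin.suc i) = at-toList w i

  at-drop : ∀ j (l : List A) i → at (drop j l) i ≡ at l (j + i)
  at-drop zero    l       i = refl
  at-drop (suc j) []      i = refl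
  at-drop (suc j) (x ∷ l) i = at-drop j l i

  at-take : ∀ j (l : List A) i → i < j → at (take j l) i ≡ at l i
  at-take (suc j) []      i       _         = refl
  at-take (suc j) (x ∷ l) zero    _         = refl
  at-take (suc j) (x ∷ l) (suc i) (s≤s i<j) = at-take j l i i<j

  at-++ˡ : ∀ (l r : List A) i → i < length l → at (l ++ r) i ≡ at l i
  at-++ˡ (x ∷ l) r zero    _         = refl
  at-++ˡ (x ∷ l) r (suc i) (s≤s i<l) = at-++ˡ l r i i<l

  at-++-length : ∀ (l r : List A) → at (l ++ r) (length l) ≡ at r 0
  at-++-length []      r = refl
  at-++-length (x ∷ l) r = at-++-length l r

  linked-at : ∀ {R : A → A → Set} {l} → Linked R l → ∀ i {x y} → at l i ≡ just x → at l (suc i) ≡ just y → R x y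
  linked-at (r ∷ _)  zero    refl refl = r
  linked-at (_ ∷ lk) (suc i) ex   ey   = linked-at lk i ex ey
  linked-at [-]      zero    _    ()
  linked-at [-]      (suc i) ()   _

nextFin-cases : ∀ m (i : Fin (suc m)) →
  (toℕ i < m × toℕ (nextFin (suc m) i) ≡ suc (toℕ i)) ⊎ (toℕ i ≡ m × nextFin (suc m) i ≡ Fin.zero)
nextFin-cases m i with m≤n⇒m<n∨m≡n (≤-pred (toℕ<n i))
... | inj₁ i<m = inj₁ (i<m , trans (toℕ-fromℕ< _) (m<n⇒m%n≡m (s≤s i<m)))
... | inj₂ i≡m = inj₂ (i≡m , toℕ-injective (trans (toℕ-fromℕ< _)
                                 (trans (cong (λ x → suc x % suc m) i≡m) (n%n≡0 (suc m)))))

closed-walk-step : ∀ {A : Set} {R : A → A → Set} h (t : List A) → Linked R (h ∷ t ++ [ h ]) →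
  ∀ i → R (Vec.lookup (Vec.fromList (h ∷ t)) i) (Vec.lookup (Vec.fromList (h ∷ t)) (nextFin (suc (length t)) i))
closed-walk-step h t walk i = linked-at walk (toℕ i) (entry i (toℕ<n i)) next-entry
  where
  C = h ∷ t
  entry : ∀ j → toℕ j < length C → at (C ++ [ h ]) (toℕ j) ≡ just (Vec.lookup (Vec.fromList C) j)
  entry j j< = trans (at-++ˡ C [ h ] (toℕ j) j<)
                 (subst (λ l → at l (toℕ j) ≡ just (Vec.lookup (Vec.fromList C) j)) (toList∘fromList C)
                   (at-toList (Vec.fromList C) j))
  next-entry : at (C ++ [ h ]) (suc (toℕ i)) ≡ just (Vec.lookup (Vec.fromList C) (nextFin (suc (length t)) i))
  next-entry with nextFin-cases (length t) i
  ... | inj₁ (i<t , next≡) =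
    subst (λ j → at (C ++ [ h ]) j ≡ just (Vec.lookup (Vec.fromList C) (nextFin (suc (length t)) i))) next≡
      (entry (nextFin (suc (length t)) i) (subst (_< length C) (sym next≡) (s≤s i<t)))
  ... | inj₂ (i≡t , next≡0) = trans (cong (λ j → at (C ++ [ h ]) (suc j)) i≡t)
                                (trans (at-++-length C [ h ]) (cong (λ j → just (Vec.lookup (Vec.fromList C) j)) (sym next≡0)))

module Overlap (n d′ s : ℕ) (k<n : suc d′ + s < n) where

  open import Data.List.Relation.Unary.Unique.DecPropositional (Fin._≟_ {n}) using (unique?)
  open import Data.List.Membership.DecPropositional (Fin._≟_ {n}) using (_∈?_)

  d : ℕ
  d = suc d′

  k : ℕ
  k = d + s

  Word : Set
  Word = List (Fin n)

  Valid : Word → Set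
  Valid w = length w ≡ k × Unique w

  valid? : ∀ w → Dec (Valid w)
  valid? w = (length w ℕ.≟ k) ×-dec unique? w

  _⟶_ : Word → Word → Set
  a ⟶ b = drop d a ≡ take s b

  _∼_ : Word → Word → Set
  a ∼ b = drop d a ≡ drop d b

  _∼?_ : ∀ a b → Dec (a ∼ b)
  a ∼? b = ≡-dec Fin._≟_ (drop d a) (drop d b)

  ρ : Word → Word
  ρ = rotate d

  words : ℕ → List Word
  words zero    = [ [] ]
  words (suc m) = cartesianProductWith _∷_ (allFin n) (words m)

  words-complete : ∀ {m} (w : Word) → length w ≡ m → w ∈ words m
  words-complete {zero}  []      refl = here refl
  words-complete {suc m} (x ∷ w) e    =
    ∈-cartesianProductWith⁺ _∷_ (∈-allFin x) (words-complete w (suc-injective e))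

  rotate-valid : ∀ j {w} → Valid w → Valid (rotate j w)
  rotate-valid j {w} (|w| , un) = trans (length-rotate j w) |w| ,
                                  Unique-resp-↭ (setoid (Fin n)) (↭⇒↭ₛ (↭-sym (rotate-↭ j w))) un

  d≤|w| : ∀ {w} → Valid w → d ≤ length w
  d≤|w| (|w| , _) = subst (d ≤_) (sym |w|) (m≤m+n d s)

  length-drop-valid : ∀ j {w} → Valid w → length (drop j w) ≡ k ∸ j
  length-drop-valid j {w} (|w| , _) = trans (length-drop j w) (cong (_∸ j) |w|)

  ρ-period : ∀ {w} → Valid w → iterate ρ w k ≡ w
  ρ-period {w} vw = subst (λ m → iterate ρ w m ≡ w) (proj₁ vw) (rotate-period d w (d≤|w| vw))

  ρ-arc : ∀ {w} → Valid w → w ⟶ ρ w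
  ρ-arc {w} vw = sym (take-++-exact (drop d w) (take d w) (trans (length-drop-valid d vw) (m+n∸m≡n d s)))

  drop-rotated : ∀ m {w} → Valid w → m * d + d ≤ k →
                 drop d (iterate ρ w m) ≡ drop (m * d + d) w ++ take (m * d) w
  drop-rotated m {w} vw fits = begin
    drop d (iterate ρ w m)                   ≡⟨ cong (drop d) (iterate-rotate-within d w (d≤|w| vw) m md≤|w|) ⟩
    drop d (drop (m * d) w ++ take (m * d) w) ≡⟨ drop-++ˡ d (drop (m * d) w) (take (m * d) w) d≤rest ⟩
    drop d (drop (m * d) w) ++ take (m * d) w ≡⟨ cong (_++ take (m * d) w) (drop-drop (m * d) d w) ⟩
    drop (m * d + d) w ++ take (m * d) w      ∎
    where
    open ≡-Reasoning
    md≤|w| : m * d ≤ length w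
    md≤|w| = subst (m * d ≤_) (sym (proj₁ vw)) (m+n≤o⇒m≤o (m * d) fits)
    d≤rest : d ≤ length (drop (m * d) w)
    d≤rest = subst (d ≤_) (sym (length-drop-valid (m * d) vw))
               (m+n≤o⇒m≤o∸n d (subst (_≤ k) (+-comm (m * d) d) fits))

  ρ-rotate-s : ∀ {w} → Valid w → ρ (rotate s w) ≡ w
  ρ-rotate-s {w} vw = trans (cong₂ _++_ (drop-++-exact (drop s w) (take s w) |drop-s|)
                                       (take-++-exact (drop s w) (take s w) |drop-s|))
                            (take++drop≡id s w)
    where
    |drop-s| : length (drop s w) ≡ d
    |drop-s| = trans (length-drop-valid s vw) (m+n∸n≡m d s)

  drop-rotate-s : ∀ {w} → Valid w → drop d (rotate s w) ≡ take s w
  drop-rotate-s {w} vw = drop-++-exact (drop s w) (take s w) (trans (length-drop-valid s vw) (m+n∸n≡m d s))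

  Position : ℕ → Set
  Position i = (∃ λ m → m * d ≤ i × i < m * d + d × m * d + d ≤ k) ⊎ s ≤ i

  position-cases : ∀ i → Position i
  position-cases i with (i / d) * d + d ≤? k
  ... | yes fits = inj₁ (i / d , m/n*n≤m i d , below , fits)
    where
    below : i < (i / d) * d + d
    below = begin-strict
      i                       ≡⟨ m≡m%n+[m/n]*n i d ⟩
      i % d + (i / d) * d     <⟨ +-monoˡ-< ((i / d) * d) (m%n<n i d) ⟩
      d + (i / d) * d         ≡⟨ +-comm d ((i / d) * d) ⟩
      (i / d) * d + d         ∎
      where open ≤-Reasoning
  ... | no ¬fits = inj₂ (<⇒≤ (<-≤-trans s<md (m/n*n≤m i d)))
    where
    s<md : s < (i / d) * d
    s<md = +-cancelʳ-< d s ((i / d) * d)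
             (subst (_< (i / d) * d + d) (+-comm d s) (≰⇒> ¬fits))

  suffix-length : ∀ t r r′ → Valid (t ++ r) → Valid (t ++ r′) → length r ≡ length r′
  suffix-length t r r′ (|tr| , _) (|tr′| , _) =
    +-cancelˡ-≡ (length t) (length r) (length r′)
      (trans (sym (length-++ t)) (trans (trans |tr| (sym |tr′|)) (length-++ t)))

  fresh : ∀ w → length w < n → ∃ λ z → z ∉ w
  fresh w |w|<n with any? (λ z → ¬? (z ∈? w)) (allFin n)
  ... | yes some = let z , _ , z∉ = find some in z , z∉
  ... | no none  = ⊥-elim (<⇒≱ |w|<n (subst (_≤ length w) (length-tabulate (λ z → z))
                     (unique-⊆-length (allFin n) w (Unique.allFin⁺ n)
                       (λ {z} _ → decidable-stable (z ∈? w) (λ z∉ → none (lose (∈-allFin z) z∉))))))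

  -- A twin may change the first d letters freely;
  -- rotations move any block of d consecutive positions to the front, so single letters
  -- can be replaced by fresh ones, and with one spare letter (k < n) any word can be
  -- turned into any other letter by letter.
  module Connectivity (P : Word → Set)
    (P-ρ : ∀ {v} → Valid v → P v → P (ρ v))
    (P-twin : ∀ {w w′} → Valid w → Valid w′ → w ∼ w′ → P w → P w′)
    where

    P-iterate : ∀ m {v} → Valid v → P v → P (iterate ρ v m)
    P-iterate m vv pv = proj₂ (iterate-preserves (λ w → Valid w × P w) ρ
                                 (λ (vw , pw) → rotate-valid d vw , P-ρ vw pw) m (vv , pv))

    -- ρ is invertible on valid words (ρ⁻¹ = ρ^(k-1)), so P is also closed under ρ⁻¹
    P-ρ⁻¹ : ∀ {v} → Valid v → P (ρ v) → P v
    P-ρ⁻¹ vv p = subst P (ρ-period vv) (P-iterate (d′ + s) (rotate-valid d vv) p)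

    P-iterate⁻¹ : ∀ m {v} → Valid v → P (iterate ρ v m) → P v
    P-iterate⁻¹ zero    vv p = p
    P-iterate⁻¹ (suc m) vv p = P-ρ⁻¹ vv (P-iterate⁻¹ m (rotate-valid d vv) p)

    -- words that differ only inside the block [m·d, m·d + d) become twins after m rotations
    block : ∀ m {w w′} → m * d + d ≤ k → Valid w → Valid w′ →
            take (m * d) w ≡ take (m * d) w′ → drop (m * d + d) w ≡ drop (m * d + d) w′ → P w → P w′
    block m fits vw vw′ same-take same-drop pw =
      P-iterate⁻¹ m vw′ (P-twin (valid-iterate vw) (valid-iterate vw′) twins (P-iterate m vw pw))
      where
      valid-iterate : ∀ {v} → Valid v → Valid (iterate ρ v m)
      valid-iterate = iterate-preserves Valid ρ (rotate-valid d) m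
      twins : iterate ρ _ m ∼ iterate ρ _ m
      twins = trans (drop-rotated m vw fits)
                (trans (cong₂ _++_ same-drop same-take) (sym (drop-rotated m vw′ fits)))

    -- words that differ only in the last d positions become twins after rotating by s
    suffix : ∀ {w w′} → Valid w → Valid w′ → take s w ≡ take s w′ → P w → P w′
    suffix {w} {w′} vw vw′ same-take pw =
      subst P (ρ-rotate-s vw′) (P-ρ (rotate-valid s vw′)
        (P-twin (rotate-valid s vw) (rotate-valid s vw′) twins
          (P-ρ⁻¹ (rotate-valid s vw) (subst P (sym (ρ-rotate-s vw)) pw))))
      where
      twins : rotate s w ∼ rotate s w′
      twins = trans (drop-rotate-s vw) (trans same-take (sym (drop-rotate-s vw′)))

    replace : ∀ u v a b → Valid (u ++ a ∷ v) → b ∉ u ++ a ∷ v → P (u ++ a ∷ v) →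
              Valid (u ++ b ∷ v) × P (u ++ b ∷ v)
    replace u v a b vw b∉ pw = vw′ , moved (position-cases (length u))
      where
      vw′ : Valid (u ++ b ∷ v)
      vw′ = trans (length-replace u v b a) (proj₁ vw) , unique-replace u v a b (proj₂ vw) b∉
      moved : Position (length u) → P (u ++ b ∷ v)
      moved (inj₁ (m , md≤ , <md+d , fits)) =
        block m fits vw vw′ (take-replace u v a b (m * d) md≤) (drop-replace u v a b (m * d + d) <md+d) pw
      moved (inj₂ s≤) = suffix vw vw′ (take-replace u v a b s s≤) pw

    -- When c ∈ r, first evict c from r by a fresh letter z, then put c after t.
    evict : ∀ t c a r → c ∈ r → Valid (t ++ a ∷ r) → P (t ++ a ∷ r) →
            ∃ λ r′ → Valid (t ++ c ∷ r′) × P (t ++ c ∷ r′)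
    evict t c a r c∈r vw pw with ∈-∃++ c∈r
    ... | r₁ , r₂ , refl = r₁ ++ z ∷ r₂ , replace t (r₁ ++ z ∷ r₂) a c (subst Valid (sym (reassoc z)) (proj₁ z-placed))
                                            c∉ (subst P (sym (reassoc z)) (proj₂ z-placed))
      where
      u : Word
      u = t ++ a ∷ r₁
      reassoc : ∀ x → t ++ a ∷ r₁ ++ x ∷ r₂ ≡ u ++ x ∷ r₂
      reassoc x = sym (++-assoc t (a ∷ r₁) (x ∷ r₂))
      vwᵘ : Valid (u ++ c ∷ r₂)
      vwᵘ = subst Valid (reassoc c) vw
      spare : ∃ λ z → z ∉ u ++ c ∷ r₂
      spare = fresh (u ++ c ∷ r₂) (subst (_< n) (sym (proj₁ vwᵘ)) k<n)
      z : Fin n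
      z = proj₁ spare
      z∉ : z ∉ u ++ c ∷ r₂
      z∉ = proj₂ spare
      z-placed : Valid (u ++ z ∷ r₂) × P (u ++ z ∷ r₂)
      z-placed = replace u r₂ c z vwᵘ z∉ (subst P (reassoc c) pw)
      -- c ≠ z since z is fresh, and c occurs only once in u ++ c ∷ r₂
      c∉ : c ∉ t ++ a ∷ r₁ ++ z ∷ r₂
      c∉ c∈ with ∈-mid u r₂ z (subst (c ∈_) (reassoc z) c∈)
      ... | inj₁ c≡z = z∉ (subst (_∈ u ++ c ∷ r₂) c≡z (∈-++⁺ʳ u (here refl)))
      ... | inj₂ c∈′ = ∉-mid u r₂ c (proj₂ vwᵘ) c∈′

    set-letter : ∀ t c a r → c ∉ t → Valid (t ++ a ∷ r) → P (t ++ a ∷ r) →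
                 ∃ λ r′ → Valid (t ++ c ∷ r′) × P (t ++ c ∷ r′)
    set-letter t c a r c∉t vw pw with c ∈? (t ++ a ∷ r)
    ... | no c∉ = r , replace t r a c vw c∉ pw
    ... | yes c∈ with ∈-mid t r a c∈
    ...   | inj₁ refl = r , vw , pw
    ...   | inj₂ c∈t++r with ∈-++⁻ t c∈t++r
    ...     | inj₁ c∈t = ⊥-elim (c∉t c∈t)
    ...     | inj₂ c∈r = evict t c a r c∈r vw pw

    -- Transform a word with prefix t₁ satisfying P into the target t₁ ++ t₂,
    -- fixing the letters of t₂ one at a time.
    reach : ∀ t₂ t₁ → Valid (t₁ ++ t₂) → (∃ λ r → Valid (t₁ ++ r) × P (t₁ ++ r)) → P (t₁ ++ t₂)
    reach []       t₁ vt ([]    , _  , pr) = pr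
    reach []       t₁ vt (_ ∷ _ , vr , _) with suffix-length t₁ _ [] vr vt
    ... | ()
    reach (c ∷ t₂) t₁ vt ([]    , vr , _) with suffix-length t₁ [] _ vr vt
    ... | ()
    reach (c ∷ t₂) t₁ vt (a ∷ r , vr , pr) with set-letter t₁ c a r c∉t₁ vr pr
      where
      c∉t₁ : c ∉ t₁
      c∉t₁ c∈ = ∉-mid t₁ t₂ c (proj₂ vt) (∈-++⁺ˡ c∈)
    ... | r′ , vr′ , pr′ =
      subst P (++-assoc t₁ [ c ] t₂)
        (reach t₂ (t₁ ++ [ c ]) (subst Valid (sym (++-assoc t₁ [ c ] t₂)) vt)
          (r′ , subst Valid (sym (++-assoc t₁ [ c ] r′)) vr′ , subst P (sym (++-assoc t₁ [ c ] r′)) pr′))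

  connected : ∀ (P : Word → Set) → (∀ {v} → Valid v → P v → P (ρ v)) →
              (∀ {w w′} → Valid w → Valid w′ → w ∼ w′ → P w → P w′) →
              ∀ {a} → Valid a → P a → ∀ {t} → Valid t → P t
  connected P P-ρ P-twin {a} va pa {t} vt = Connectivity.reach P P-ρ P-twin t [] vt (a , va , pa)

  a₀-valid : Valid (take k (allFin n))
  a₀-valid = trans (length-take k (allFin n)) (m≤n⇒m⊓n≡m (subst (k ≤_) (sym (length-tabulate (λ z → z))) (<⇒≤ k<n))) ,
             Unique.take⁺ k (Unique.allFin⁺ n)

  -- twins x ∼ y share drop d, hence all arcs
  open CycleJoining (≡-dec Fin._≟_) Valid valid? (words k) (λ vw → words-complete _ (proj₁ vw))
         _⟶_ ρ (rotate-valid d) (d′ + s) ρ-period ρ-arc _∼_ _∼?_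
         (λ x∼y x⟶z → trans (sym x∼y) x⟶z) (λ x∼y y⟶z → trans x∼y y⟶z) connected a₀-valid
    using (PartialCycle; hamiltonian)

  toKPerm : ∀ w → Valid w → KPerm k n
  toKPerm w (|w| , un) = kperm (vecOf w |w|) λ i j i≢j e →
    i≢j (lookup-injective (vecOf w |w|) (subst Unique (sym (toList-vecOf w |w|)) un) i j e)

  kperm-valid : ∀ (a : KPerm k n) → Valid (Vec.toList (word a))
  kperm-valid a = length-toList (word a) , unique-toList (word a) (distinct a)

  arc-transfer : ∀ {a b} (va : Valid a) (vb : Valid b) → a ⟶ b → Arc k n s (toKPerm a va) (toKPerm b vb)
  arc-transfer {a} {b} va vb a⟶b i j j<s i≡ = just-injective (begin
    just (Vec.lookup A i)         ≡⟨ sym (at-toList A i) ⟩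
    at (Vec.toList A) (toℕ i)     ≡⟨ cong₂ at (toList-vecOf a (proj₁ va)) (trans i≡ (cong (_+ toℕ j) (m+n∸n≡m d s))) ⟩
    at a (d + toℕ j)              ≡⟨ sym (at-drop d a (toℕ j)) ⟩
    at (drop d a) (toℕ j)         ≡⟨ cong (λ l → at l (toℕ j)) a⟶b ⟩
    at (take s b) (toℕ j)         ≡⟨ at-take s b (toℕ j) j<s ⟩
    at b (toℕ j)                  ≡⟨ cong (λ l → at l (toℕ j)) (sym (toList-vecOf b (proj₁ vb))) ⟩
    at (Vec.toList B) (toℕ j)     ≡⟨ at-toList B j ⟩
    just (Vec.lookup B j)         ∎)
    where
    open ≡-Reasoning
    A B : Vec (Fin n) k
    A = word (toKPerm a va)
    B = word (toKPerm b vb)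

  from-word-cycle : ∀ h t → Linked _⟶_ (h ∷ t ++ [ h ]) → Unique (h ∷ t) →
                    (∀ {v} → v ∈ h ∷ t → Valid v) → (∀ {v} → Valid v → v ∈ h ∷ t) → IsHamiltonianP k n s
  from-word-cycle h t walk un valid covers = length t , c , injective , surjective , arcs
    where
    C : Vec Word (suc (length t))
    C = Vec.fromList (h ∷ t)
    entry-valid : ∀ i → Valid (Vec.lookup C i)
    entry-valid i = valid (subst (Vec.lookup C i ∈_) (toList∘fromList (h ∷ t)) (∈-toList⁺ (∈-lookup i C)))
    c : Fin (suc (length t)) → KPerm k n
    c i = toKPerm (Vec.lookup C i) (entry-valid i)
    injective : ∀ i j → word (c i) ≡ word (c j) → i ≡ j
    injective i j e = lookup-injective C (subst Unique (sym (toList∘fromList (h ∷ t))) un) i j (begin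
      Vec.lookup C i               ≡⟨ sym (toList-vecOf _ (proj₁ (entry-valid i))) ⟩
      Vec.toList (word (c i))      ≡⟨ cong Vec.toList e ⟩
      Vec.toList (word (c j))      ≡⟨ toList-vecOf _ (proj₁ (entry-valid j)) ⟩
      Vec.lookup C j               ∎)
      where open ≡-Reasoning
    -- a k-permutation's word is valid, hence on the cycle
    surjective : ∀ a → ∃ λ i → word (c i) ≡ word a
    surjective a = i , vecOf-toList (Vec.lookup C i) (proj₁ (entry-valid i)) (word a) (sym (VAny.lookup-index a∈))
      where
      a∈ : Vec.toList (word a) ∈ᵥ C
      a∈ = ∈-toList⁻ (subst (Vec.toList (word a) ∈_) (sym (toList∘fromList (h ∷ t))) (covers (kperm-valid a)))
      i : Fin (suc (length t))
      i = VAny.index a∈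
    arcs : ∀ i → Arc k n s (c i) (c (nextFin (suc (length t)) i))
    arcs i = arc-transfer (entry-valid i) (entry-valid (nextFin (suc (length t)) i)) (closed-walk-step h t walk i)

  overlap-hamiltonian : IsHamiltonianP k n s
  overlap-hamiltonian with hamiltonian
  ... | st , covers with PartialCycle.C st | PartialCycle.cyclic st | PartialCycle.unique st | PartialCycle.valid st
  ...   | h ∷ t | walk | un | valid = from-word-cycle h t walk un valid covers

-- The theorem: write k = d + s with d = k - s ≥ 1 and apply the above.
-- (The construction does not need s ≥ 1.)
corollary1 : ∀ (n k s : ℕ) → 1 ≤ s → s < k → k < n → IsHamiltonianP k n s
corollary1 n k s _ s<k k<n =
  subst (λ k′ → IsHamiltonianP k′ n s) k≡ (Overlap.overlap-hamiltonian n d′ s (subst (_< n) (sym k≡) k<n))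
  where
  d′ : ℕ
  d′ = proj₁ (m≤n⇒∃[o]m+o≡n s<k)
  k≡ : suc d′ + s ≡ k
  k≡ = trans (cong suc (+-comm d′ s)) (proj₂ (m≤n⇒∃[o]m+o≡n s<k))
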